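{- For every integer $r\ge4$, the set $\Psi_r^*$ is infinite.
   Context: $\Psi_r$ is the set of 4-connected $r$-regular graphs of class 1 (edge chromatic number equal to maximum degree) that contain an equivalent set of size 2, where a non-empty edge set $S$ of $H$ is an equivalent set if $S\cap M=\emptyset$ or $S\cap M=S$ for every perfect matching $M$ of $H$. $\Psi_r^*$ is the set of graphs $H\in\Psi_r$ containing an equivalent set $\{e,e'\}$ of size 2 such that $H-\{e,e'\}$ is not bipartite. -}

module Defs where

open import Data.Nat using (ℕ; _<_; _≤_)
open import Data.Fin using (Fin)
open import Data.Fin.Properties using (_≟_)
open import Data.Bool using (Bool; true; false)
open import Data.Product using (Σ; ∃; ∃-syntax; _×_; _,_; proj₁; proj₂)
open import Data.Sum using (_⊎_; inj₁; inj₂)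
open import Data.List using (List; length; filter)
open import Data.List.Base using ()
open import Data.List.Membership.Propositional using (_∉_)
open import Data.List.Relation.Unary.Any using ()
open import Data.Fin.Base using ()
open import Data.List using (allFin)
open import Relation.Nullary using (¬_; Dec; yes; no)
open import Relation.Nullary.Decidable using (_⊎-dec_)
open import Relation.Binary.PropositionalEquality using (_≡_; _≢_)

-- A finite loopless multigraph: vertices Fin n, edges Fin m, each edge
-- has two distinct ends (parallel edges allowed).
record Graph : Set where
  field
    n        : ℕ
    m        : ℕ
    ends     : Fin m → Fin n × Fin n
    loopless : ∀ e → proj₁ (ends e) ≢ proj₂ (ends e)

module _ (G : Graph) where
  open Graph G

  Incident : Fin n → Fin m → Set
  Incident v e = v ≡ proj₁ (ends e) ⊎ v ≡ proj₂ (ends e)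

  incident? : ∀ v e → Dec (Incident v e)
  incident? v e = (v ≟ proj₁ (ends e)) ⊎-dec (v ≟ proj₂ (ends e))

  degree : Fin n → ℕ
  degree v = length (filter (incident? v) (allFin m))

  Regular : ℕ → Set
  Regular r = ∀ v → degree v ≡ r

  ProperEdgeColouring : (k : ℕ) → (Fin m → Fin k) → Set
  ProperEdgeColouring k c =
    ∀ e e' v → e ≢ e' → Incident v e → Incident v e' → c e ≢ c e'

  -- class 1 for an r-regular graph: edge chromatic number = Δ = r,
  -- i.e. (since χ' ≥ Δ always) there is a proper r-edge-colouring.
  Class1 : ℕ → Set
  Class1 r = Σ (Fin m → Fin r) (ProperEdgeColouring r)

  Adj : Fin n → Fin n → Set
  Adj u v = ∃[ e ] (ends e ≡ (u , v) ⊎ ends e ≡ (v , u))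

  data Reach (X : Fin n → Set) : Fin n → Fin n → Set where
    here : ∀ {u} → Reach X u u
    step : ∀ {u w v} → Adj u w → X w → Reach X w v → Reach X u v

  KConnected : ℕ → Set
  KConnected k = k < n ×
    (∀ (R : List (Fin n)) → length R < k →
       ∀ u v → u ∉ R → v ∉ R → Reach (λ w → w ∉ R) u v)

  PerfectMatching : (Fin m → Bool) → Set
  PerfectMatching M =
    ∀ v → (∃[ e ] (M e ≡ true × Incident v e)) ×
          (∀ e e' → M e ≡ true → M e' ≡ true →
             Incident v e → Incident v e' → e ≡ e')

  EquivalentSet : (Fin m → Set) → Set
  EquivalentSet S = (∃[ e ] S e) ×
    (∀ M → PerfectMatching M →
       (∀ e → S e → M e ≡ false) ⊎ (∀ e → S e → M e ≡ true))

  Pair : Fin m → Fin m → Fin m → Set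
  Pair e e' x = x ≡ e ⊎ x ≡ e'

  BipartiteWithout : Fin m → Fin m → Set
  BipartiteWithout e e' = Σ (Fin n → Bool) λ f →
    ∀ x → ¬ Pair e e' x → f (proj₁ (ends x)) ≢ f (proj₂ (ends x))

  InPsi : ℕ → Set
  InPsi r = KConnected 4 × Regular r × Class1 r ×
    (∃[ e ] ∃[ e' ] (e ≢ e' × EquivalentSet (Pair e e')))

  InPsiStar : ℕ → Set
  InPsiStar r = KConnected 4 × Regular r × Class1 r ×
    (∃[ e ] ∃[ e' ] (e ≢ e' × EquivalentSet (Pair e e') ×
                     ¬ BipartiteWithout e e'))

-- For every u the graph H_u consists of 14 core vertices and a ladder of u + 1 rungs: each rung is
-- a K₂,₂, consecutive rungs are joined by a K₂,₂, and the two ends of the ladder are attached to the core.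
-- Its edge set is the union of four perfect matchings, the first one repeated r − 4 times, so colouring each
-- edge by its matching shows that H_u is r-regular of class 1.
-- A perfect matching containing a₁a₂ but not b₀b₁ must match x₁ and x₂ to two spokes sᵢ whose partners bᵢ
-- would both need a₃; one containing b₀b₁ but not a₁a₂ must match a₁, a₂, a₃ into {b₂, b₃}. Hence
-- {a₁a₂, b₀b₁} is an equivalent set, and deleting it leaves the odd cycle through w₀ and one lane of the ladder.
-- After deleting at most three vertices, every other vertex still reaches a spoke s₀…s₃ or x₁, x₂ along one of
-- four internally disjoint routes, and these anchors all reach a common hub, so H_u is 4-connected.
-- H_u has 18 + 4u vertices.
module Submission where

open import Defs
open import Data.Nat using (ℕ; zero; suc; _+_; _*_; _≤_; _<_; z≤n; s≤s)
open import Data.Nat.Properties as ℕₚ using (≤-antisym; <⇒≱; <-irrefl; <-asym; ≤-trans; n<1+n; m≤m+n; m≤n+m; m≤m*n; +-suc)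
open import Data.Bool using (Bool; true; false; not; if_then_else_)
import Data.Bool.Properties as Bool
open import Data.Empty using (⊥; ⊥-elim)
open import Data.Fin using (Fin; zero; suc; fromℕ; inject₁; toℕ)
open import Data.Fin.Patterns using (0F; 1F; 2F; 3F; 4F; 5F; 6F; 7F; 8F; 9F)
import Data.Fin.Properties as Fin
open import Data.Fin.Properties using (_≟_; any?; all?; injective⇒≤; +↔⊎; *↔×; 2↔Bool)
open import Data.Fin.Induction using (<-weakInduction; >-weakInduction)
open import Data.Fin.Relation.Unary.Top using (View; view; ‵fromℕ; ‵inj₁; ‵inject₁; view-fromℕ; view-inject₁)
open import Data.Maybe as Maybe using (Maybe; just; nothing)
open import Data.Product using (Σ; ∃; _×_; _,_; proj₁; proj₂)
import Data.Product.Properties as Product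
open import Data.Product.Function.NonDependent.Propositional using (_×-↔_)
open import Data.Sum using (_⊎_; inj₁; inj₂)
import Data.Sum.Properties as Sum
open import Data.Sum.Function.Propositional using (_⊎-↔_)
open import Data.Vec as Vec using (Vec; []; _∷_)
open import Data.List using (List; []; _∷_; length; lookup; map; filter; allFin)
open import Data.List.Properties using (length-tabulate; length-map)
open import Data.List.Relation.Unary.All as All using (All; []; _∷_)
import Data.List.Relation.Unary.All.Properties as AllP
open import Data.List.Relation.Unary.Any as Any using (Any; here; there)
open import Data.List.Relation.Unary.Any.Properties using (lookup-index)
open import Data.List.Relation.Unary.AllPairs using (AllPairs; []; _∷_; allPairs?)
import Data.List.Relation.Unary.AllPairs.Properties as AllPairs
open import Data.List.Relation.Unary.Unique.Propositional using (Unique)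
open import Data.List.Relation.Unary.Unique.Propositional.Properties using (allFin⁺; filter⁺)
import Data.List.Relation.Unary.Unique.DecPropositional as DecUnique
open import Data.List.Relation.Binary.Disjoint.Propositional using () renaming (Disjoint to DisjointLists)
import Data.List.Relation.Binary.Disjoint.DecPropositional as DecDisjoint
open import Data.List.Membership.Propositional using (_∈_; _∉_)
open import Data.List.Membership.Propositional.Properties using (∈-lookup; ∈-filter⁺; ∈-filter⁻; ∈-allFin)
import Data.List.Membership.DecPropositional as DecMembership
open import Function using (id; _∋_; case_of_)
open import Function.Bundles using (_↔_; Inverse)
open import Function.Properties.Inverse using (↔-refl; ↔-sym; ↔-trans)
open import Relation.Nullary using (¬_; Dec; yes; no; does; ¬?)
open import Relation.Nullary.Decidable using (True; toWitness; from-yes; decidable-stable; _⊎-dec_; _×-dec_; _→-dec_)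
open import Relation.Unary using () renaming (_⊥_ to Disjoint)
open import Relation.Binary.Definitions using (DecidableEquality)
open import Relation.Binary.PropositionalEquality
  using (_≡_; _≢_; refl; sym; trans; cong; subst; subst₂; ≢-sym; module ≡-Reasoning)

unique-lookup-injective : ∀ {A : Set} {xs : List A} → Unique xs →
  ∀ i j → lookup xs i ≡ lookup xs j → i ≡ j
unique-lookup-injective (_ ∷ _) zero zero _ = refl
unique-lookup-injective (x∉ ∷ _) zero (suc j) eq = ⊥-elim (All.lookup x∉ (∈-lookup j) eq)
unique-lookup-injective (x∉ ∷ _) (suc i) zero eq = ⊥-elim (All.lookup x∉ (∈-lookup i) (sym eq))
unique-lookup-injective (_ ∷ u) (suc i) (suc j) eq = cong suc (unique-lookup-injective u i j eq)

length-≤-by-injection : ∀ {A B : Set} {xs : List A} {ys : List B} → Unique xs →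
  (f : A → B) → (∀ {a b} → a ∈ xs → b ∈ xs → f a ≡ f b → a ≡ b) →
  (∀ {a} → a ∈ xs → f a ∈ ys) → length xs ≤ length ys
length-≤-by-injection {xs = xs} {ys} xs-unique f f-inj f∈ys = injective⇒≤ index-injective
  where
  position : Fin (length xs) → Fin (length ys)
  position i = Any.index (f∈ys (∈-lookup i))

  index-injective : ∀ {i j} → position i ≡ position j → i ≡ j
  index-injective {i} {j} eq = unique-lookup-injective xs-unique i j
    (f-inj (∈-lookup i) (∈-lookup j) (begin
      f (lookup xs i)                ≡⟨ lookup-index (f∈ys (∈-lookup i)) ⟩
      lookup ys (position i)         ≡⟨ cong (lookup ys) eq ⟩
      lookup ys (position j)         ≡⟨ sym (lookup-index (f∈ys (∈-lookup j))) ⟩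
      f (lookup xs j)                ∎))
    where open ≡-Reasoning

module _ (G : Graph) where
  open Graph G

  Adj-sym : ∀ {u v} → Adj G u v → Adj G v u
  Adj-sym (e , inj₁ p) = e , inj₂ p
  Adj-sym (e , inj₂ p) = e , inj₁ p

module _ {G : Graph} {X : Fin (Graph.n G) → Set} where

  infixr 5 _◅◅_
  _◅◅_ : ∀ {u v w} → Reach G X u v → Reach G X v w → Reach G X u w
  here ◅◅ q = q
  step a xv p ◅◅ q = step a xv (p ◅◅ q)

  Reach-reverse : ∀ {u v} → X u → Reach G X u v → Reach G X v u
  Reach-reverse xu here = here
  Reach-reverse xu (step a xw p) = Reach-reverse xw p ◅◅ step (Adj-sym G a) xu here

module _ (G : Graph) where
  open Graph G

  module _ {r : ℕ} (colour : Fin m → Fin r) (edgeAt : Fin n → Fin r → Fin m)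
    (colour-edgeAt : ∀ v c → colour (edgeAt v c) ≡ c)
    (incident-edgeAt : ∀ v c → Incident G v (edgeAt v c))
    (incident⇒edgeAt : ∀ v e → Incident G v e → e ≡ edgeAt v (colour e)) where

    matchingColouring-class1 : Class1 G r
    matchingColouring-class1 = colour , proper
      where
      proper : ProperEdgeColouring G r colour
      proper e e′ v e≢e′ ve ve′ same = e≢e′ (begin
        e                        ≡⟨ incident⇒edgeAt v e ve ⟩
        edgeAt v (colour e)      ≡⟨ cong (edgeAt v) same ⟩
        edgeAt v (colour e′)     ≡⟨ sym (incident⇒edgeAt v e′ ve′) ⟩
        e′                       ∎)
        where open ≡-Reasoning

    matchingColouring-regular : Regular G r
    matchingColouring-regular v = ≤-antisym degree≤r r≤degree
      where
      incidentEdges : List (Fin m)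
      incidentEdges = filter (incident? G v) (allFin m)

      incident : ∀ {e} → e ∈ incidentEdges → Incident G v e
      incident e∈ = proj₂ (∈-filter⁻ (incident? G v) {xs = allFin m} e∈)

      degree≤r : degree G v ≤ r
      degree≤r = subst (degree G v ≤_) (length-tabulate {n = r} id)
        (length-≤-by-injection (filter⁺ (incident? G v) (allFin⁺ m)) colour
          (λ e∈ e′∈ eq → trans (incident⇒edgeAt v _ (incident e∈))
            (trans (cong (edgeAt v) eq) (sym (incident⇒edgeAt v _ (incident e′∈)))))
          (λ _ → ∈-allFin _))

      r≤degree : r ≤ degree G v
      r≤degree = subst (_≤ degree G v) (length-tabulate {n = r} id)
        (length-≤-by-injection (allFin⁺ r) (edgeAt v)
          (λ {c} {c′} _ _ eq → trans (sym (colour-edgeAt v c)) (trans (cong colour eq) (colour-edgeAt v c′)))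
          (λ {c} _ → ∈-filter⁺ (incident? G v) (∈-allFin (edgeAt v c)) (incident-edgeAt v c)))

  equivalentPair : ∀ {e e′} →
    (∀ M → PerfectMatching G M → M e ≡ true → M e′ ≡ true) →
    (∀ M → PerfectMatching G M → M e′ ≡ true → M e ≡ true) →
    EquivalentSet G (Pair G e e′)
  equivalentPair {e} {e′} e⇒e′ e′⇒e = (e , inj₁ refl) , all-or-nothing
    where
    all-or-nothing : ∀ M → PerfectMatching G M →
      (∀ x → Pair G e e′ x → M x ≡ false) ⊎ (∀ x → Pair G e e′ x → M x ≡ true)
    all-or-nothing M perfect with M e in Me | M e′ in Me′
    ... | true  | true  = inj₂ λ { _ (inj₁ refl) → Me ; _ (inj₂ refl) → Me′ }
    ... | false | false = inj₁ λ { _ (inj₁ refl) → Me ; _ (inj₂ refl) → Me′ }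
    ... | true  | false with () ← trans (sym Me′) (e⇒e′ M perfect Me)
    ... | false | true  with () ← trans (sym Me) (e′⇒e M perfect Me′)

_IsEndOf_ : ∀ {V : Set} → V → V × V → Set
v IsEndOf (a , b) = v ≡ a ⊎ v ≡ b

Joins : ∀ {V : Set} → V × V → V → V → Set
Joins p v z = p ≡ (v , z) ⊎ p ≡ (z , v)

joins⇒endOf : ∀ {V : Set} {p : V × V} {v z} → Joins p v z → v IsEndOf p
joins⇒endOf (inj₁ refl) = inj₁ refl
joins⇒endOf (inj₂ refl) = inj₂ refl

other : ∀ {V : Set} → DecidableEquality V → V → V × V → V
other _≟_ v (a , b) with v ≟ a
... | yes _ = b
... | no _  = a

joins⇒other : ∀ {V : Set} (_≟_ : DecidableEquality V) {p : V × V} {v z} → Joins p v z → z ≡ other _≟_ v p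
joins⇒other _≟_ {v = v} (inj₁ refl) with v ≟ v
... | yes _ = refl
... | no v≢v = ⊥-elim (v≢v refl)
joins⇒other _≟_ {v = v} {z} (inj₂ refl) with v ≟ z
... | yes v≡z = sym v≡z
... | no _ = refl

pigeonhole₃ : ∀ (p q r : Bool) → p ≡ q ⊎ p ≡ r ⊎ q ≡ r
pigeonhole₃ false false _     = inj₁ refl
pigeonhole₃ true  true  _     = inj₁ refl
pigeonhole₃ false true  false = inj₂ (inj₁ refl)
pigeonhole₃ false true  true  = inj₂ (inj₂ refl)
pigeonhole₃ true  false false = inj₂ (inj₂ refl)
pigeonhole₃ true  false true  = inj₂ (inj₁ refl)

-- The multigraph on V whose edges of colour c are the pairs pair c s of a perfect matching,
-- s ranging over the slots S; slot c v is the slot of the pair of colour c containing v.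
module MatchingUnion {V S : Set} {n h r : ℕ} (vertexCode : V ↔ Fin n) (slotCode : S ↔ Fin h)
  (pair : Fin r → S → V × V) (slot : Fin r → V → S)
  (slot-endOf : ∀ c v → v IsEndOf pair c (slot c v))
  (endOf-slot : ∀ c s v → v IsEndOf pair c s → s ≡ slot c v)
  (pair-loopless : ∀ c s → proj₁ (pair c s) ≢ proj₂ (pair c s)) where

  encode : V → Fin n
  encode = Inverse.to vertexCode

  decode : Fin n → V
  decode = Inverse.from vertexCode

  encode-decode : ∀ x → encode (decode x) ≡ x
  encode-decode = Inverse.strictlyInverseˡ vertexCode

  decode-encode : ∀ v → decode (encode v) ≡ v
  decode-encode = Inverse.strictlyInverseʳ vertexCode

  encode-injective : ∀ {v w} → encode v ≡ encode w → v ≡ w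
  encode-injective {v} {w} eq = trans (sym (decode-encode v)) (trans (cong decode eq) (decode-encode w))

  encodePair : V × V → Fin n × Fin n
  encodePair (a , b) = encode a , encode b

  edgeCode : (Fin r × S) ↔ Fin (r * h)
  edgeCode = ↔-trans (↔-refl ×-↔ slotCode) (↔-sym *↔×)

  open Inverse edgeCode using ()
    renaming (to to edge′; from to colourSlot; strictlyInverseˡ to edge-colourSlot; strictlyInverseʳ to colourSlot-edge)

  edge : Fin r → S → Fin (r * h)
  edge c s = edge′ (c , s)

  colour : Fin (r * h) → Fin r
  colour e = proj₁ (colourSlot e)

  slotOf : Fin (r * h) → S
  slotOf e = proj₂ (colourSlot e)

  graph : Graph
  graph = record
    { n        = n
    ; m        = r * h
    ; ends     = λ e → encodePair (pair (colour e) (slotOf e))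
    ; loopless = λ e eq → pair-loopless (colour e) (slotOf e) (encode-injective eq)
    }

  edge-injective : ∀ {c c′ s s′} → edge c s ≡ edge c′ s′ → c ≡ c′ × s ≡ s′
  edge-injective {c} {c′} {s} {s′} eq = cong proj₁ eq′ , cong proj₂ eq′
    where
    eq′ : (c , s) ≡ (c′ , s′)
    eq′ = trans (sym (colourSlot-edge (c , s))) (trans (cong colourSlot eq) (colourSlot-edge (c′ , s′)))

  pair-edge : ∀ c s → pair (colour (edge c s)) (slotOf (edge c s)) ≡ pair c s
  pair-edge c s = cong (λ p → pair (proj₁ p) (proj₂ p)) (colourSlot-edge (c , s))

  ends-edge : ∀ c s → Graph.ends graph (edge c s) ≡ encodePair (pair c s)
  ends-edge c s = cong encodePair (pair-edge c s)

  adjacent : ∀ c s → Adj graph (encode (proj₁ (pair c s))) (encode (proj₂ (pair c s)))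
  adjacent c s = edge c s , inj₁ (ends-edge c s)

  incident-edge : ∀ {v c s} → v IsEndOf pair c s → Incident graph (encode v) (edge c s)
  incident-edge {c = c} {s} (inj₁ refl) = inj₁ (cong (λ p → encode (proj₁ p)) (sym (pair-edge c s)))
  incident-edge {c = c} {s} (inj₂ refl) = inj₂ (cong (λ p → encode (proj₂ p)) (sym (pair-edge c s)))

  incident⇒endOf : ∀ {x e} → Incident graph x e → decode x IsEndOf pair (colour e) (slotOf e)
  incident⇒endOf (inj₁ refl) = inj₁ (decode-encode _)
  incident⇒endOf (inj₂ refl) = inj₂ (decode-encode _)

  edgeAt : Fin n → Fin r → Fin (r * h)
  edgeAt x c = edge c (slot c (decode x))

  colour-edgeAt : ∀ x c → colour (edgeAt x c) ≡ c
  colour-edgeAt x c = cong proj₁ (colourSlot-edge (c , slot c (decode x)))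

  incident-edgeAt : ∀ x c → Incident graph x (edgeAt x c)
  incident-edgeAt x c = subst (λ y → Incident graph y (edgeAt x c)) (encode-decode x)
    (incident-edge (slot-endOf c (decode x)))

  incident⇒edgeAt : ∀ x e → Incident graph x e → e ≡ edgeAt x (colour e)
  incident⇒edgeAt x e inc = trans (sym (edge-colourSlot e))
    (cong (edge (colour e)) (endOf-slot (colour e) (slotOf e) (decode x) (incident⇒endOf inc)))

  class1 : Class1 graph r
  class1 = matchingColouring-class1 graph colour edgeAt colour-edgeAt incident-edgeAt incident⇒edgeAt

  regular : Regular graph r
  regular = matchingColouring-regular graph colour edgeAt colour-edgeAt incident-edgeAt incident⇒edgeAt

  module PartnersUnder (M : Fin (r * h) → Bool) where

    record Partner (v z : V) : Set where
      constructor partner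
      field
        colour′ : Fin r
        slot′   : S
        member  : M (edge colour′ slot′) ≡ true
        joins   : Joins (pair colour′ slot′) v z

    Partner-sym : ∀ {v z} → Partner v z → Partner z v
    Partner-sym (partner c s m (inj₁ eq)) = partner c s m (inj₂ eq)
    Partner-sym (partner c s m (inj₂ eq)) = partner c s m (inj₁ eq)

    partner-joined : ∀ {v z} → Partner v z → Σ (Fin r) λ c → Joins (pair c (slot c v)) v z
    partner-joined {v} (partner c s _ j) = c , subst (λ s → Joins (pair c s) _ _) (endOf-slot c s v (joins⇒endOf j)) j

    partner⇒member : ∀ {v z e} → Partner v z → (∀ c s → Joins (pair c s) v z → edge c s ≡ e) → M e ≡ true
    partner⇒member (partner c s m j) only = subst (λ e → M e ≡ true) (only c s j) m

    module _ (M-perfect : PerfectMatching graph M) where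

      partner-exists : ∀ v → ∃ (Partner v)
      partner-exists v with proj₁ (M-perfect (encode v))
      ... | e , Me , inc = from-end (incident⇒endOf inc)
        where
        p : V × V
        p = pair (colour e) (slotOf e)

        member′ : M (edge (colour e) (slotOf e)) ≡ true
        member′ = trans (cong M (edge-colourSlot e)) Me

        from-end : decode (encode v) IsEndOf p → ∃ (Partner v)
        from-end (inj₁ eq) = proj₂ p , partner (colour e) (slotOf e) member′ (inj₁ (cong (_, proj₂ p) (trans (sym eq) (decode-encode v))))
        from-end (inj₂ eq) = proj₁ p , partner (colour e) (slotOf e) member′ (inj₂ (cong (proj₁ p ,_) (trans (sym eq) (decode-encode v))))

      partner-unique : ∀ {v z z′} → Partner v z → Partner v z′ → z ≡ z′
      partner-unique {v} (partner c s m j) (partner c′ s′ m′ j′)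
        with edge-injective (proj₂ (M-perfect (encode v)) _ _ m m′ (incident-edge (joins⇒endOf j)) (incident-edge (joins⇒endOf j′)))
      ... | refl , refl = joins-functional j j′
        where
        joins-functional : ∀ {p z z′} → Joins p v z → Joins p v z′ → z ≡ z′
        joins-functional (inj₁ refl) (inj₁ eq) = cong proj₂ eq
        joins-functional (inj₁ refl) (inj₂ eq) = trans (cong proj₂ eq) (cong proj₁ eq)
        joins-functional (inj₂ refl) (inj₁ eq) = trans (cong proj₁ eq) (cong proj₂ eq)
        joins-functional (inj₂ refl) (inj₂ eq) = cong proj₁ eq

module Fans (G : Graph) {V : Set} (encode : V → Fin (Graph.n G))
  (encode-injective : ∀ {v w} → encode v ≡ encode w → v ≡ w) where

  infix 4 _—_
  record _—_ (v w : V) : Set where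
    constructor adj
    field adjacency : Adj G (encode v) (encode w)

  —-sym : ∀ {v w} → v — w → w — v
  —-sym (adj a) = adj (Adj-sym G a)

  module Search (R : List (Fin (Graph.n G))) (Target : V → Set) where

    open DecMembership (_≟_ {Graph.n G}) using (_∈?_)

    Kept : V → Set
    Kept v = encode v ∉ R

    record Escapes (v : V) : Set where
      constructor escape
      field
        target      : V
        on-target   : Target target
        target-kept : Kept target
        walk        : Reach G (_∉ R) (encode v) (encode target)

    Blocked : (V → Set) → Set
    Blocked P = Σ V λ z → encode z ∈ R × P z

    EscapesOrBlocked : (V → Set) → V → Set
    EscapesOrBlocked P v = Escapes v ⊎ Blocked P

    arrive : ∀ {P t} → Target t → Kept t → EscapesOrBlocked P t
    arrive tt kept = inj₁ (escape _ tt kept here)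

    via : ∀ {P v w} → v — w → P w → (Kept w → EscapesOrBlocked P w) → EscapesOrBlocked P v
    via {w = w} (adj a) pw continue with encode w ∈? R
    ... | yes removed = inj₂ (w , removed , pw)
    ... | no kept with continue kept
    ...   | inj₁ (escape t tt kt walk) = inj₁ (escape t tt kt (step a kept walk))
    ...   | inj₂ blocked = inj₂ blocked

    EscapesOrBlocked-mono : ∀ {P Q v} → (∀ {z} → P z → Q z) → EscapesOrBlocked P v → EscapesOrBlocked Q v
    EscapesOrBlocked-mono P⊆Q (inj₁ esc) = inj₁ esc
    EscapesOrBlocked-mono P⊆Q (inj₂ (z , removed , pz)) = inj₂ (z , removed , P⊆Q pz)

    private
      witnesses : ∀ {Ps} → All Blocked Ps → List (Fin (Graph.n G))
      witnesses [] = []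
      witnesses ((z , _) ∷ bs) = encode z ∷ witnesses bs

      witnesses-length : ∀ {Ps} (bs : All Blocked Ps) → length (witnesses bs) ≡ length Ps
      witnesses-length [] = refl
      witnesses-length (_ ∷ bs) = cong suc (witnesses-length bs)

      witnesses-removed : ∀ {Ps x} (bs : All Blocked Ps) → x ∈ witnesses bs → x ∈ R
      witnesses-removed ((_ , removed , _) ∷ bs) (here refl) = removed
      witnesses-removed (_ ∷ bs) (there x∈) = witnesses-removed bs x∈

      witnesses-unique : ∀ {Ps} → AllPairs Disjoint Ps → (bs : All Blocked Ps) → Unique (witnesses bs)
      witnesses-unique [] [] = []
      witnesses-unique (d ∷ ds) ((z , _ , pz) ∷ bs) = fresh d bs ∷ witnesses-unique ds bs
        where
        fresh : ∀ {Qs} → All (Disjoint _) Qs → (bs : All Blocked Qs) → All (encode z ≢_) (witnesses bs)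
        fresh [] [] = []
        fresh (dq ∷ dqs) ((z′ , _ , qz′) ∷ bs) =
          (λ eq → dq (pz , subst _ (sym (encode-injective eq)) qz′)) ∷ fresh dqs bs

      escapes-or-all-blocked : ∀ {Ps v} → All (λ P → EscapesOrBlocked P v) Ps → Escapes v ⊎ All Blocked Ps
      escapes-or-all-blocked [] = inj₂ []
      escapes-or-all-blocked (inj₁ esc ∷ _) = inj₁ esc
      escapes-or-all-blocked (inj₂ b ∷ searches) with escapes-or-all-blocked searches
      ... | inj₁ esc = inj₁ esc
      ... | inj₂ bs = inj₂ (b ∷ bs)

    -- Fewer removed vertices than pairwise disjoint regions: one search gets through.
    fan : ∀ {v} (Ps : List (V → Set)) → AllPairs Disjoint Ps → length R < length Ps →
          All (λ P → EscapesOrBlocked P v) Ps → Escapes v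
    fan Ps disjoint short searches with escapes-or-all-blocked searches
    ... | inj₁ esc = esc
    ... | inj₂ bs = ⊥-elim (<⇒≱ short (subst (_≤ length R) (witnesses-length bs)
            (length-≤-by-injection (witnesses-unique disjoint bs) (λ x → x) (λ _ _ eq → eq) (witnesses-removed bs))))

    some-kept : (vs : List V) → Unique vs → length R < length vs → Any Kept vs
    some-kept vs distinct short with Any.any? (λ v → ¬? (encode v ∈? R)) vs
    ... | yes kept = kept
    ... | no none = ⊥-elim (<⇒≱ short (length-≤-by-injection distinct encode (λ _ _ → encode-injective) removed))
      where
      removed : ∀ {v} → v ∈ vs → encode v ∈ R
      removed {v} v∈ = decidable-stable (encode v ∈? R) (All.lookup (AllP.¬Any⇒All¬ vs none) v∈)

    infixr 5 _◅_
    data Route : V → List V → Set where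
      end : ∀ {t} → Target t → Route t []
      _◅_ : ∀ {v w ws} → v — w → Route w ws → Route v (w ∷ ws)

    route-search : ∀ {v ws} → Route v ws → Kept v → EscapesOrBlocked (_∈ ws) v
    route-search (end tt) kept = arrive tt kept
    route-search (a ◅ route) kept = via a (here refl) (λ kw → EscapesOrBlocked-mono there (route-search route kw))

    route-fan : ∀ {v} (routes : List (List V)) → AllPairs DisjointLists routes → length R < length routes →
                All (Route v) routes → Kept v → Escapes v
    route-fan routes disjoint short rs kept = fan (map (λ ws → _∈ ws) routes) (AllPairs.map⁺ disjoint)
      (subst (length R <_) (sym (length-map _ routes)) short) (AllP.map⁺ (All.map (λ r → route-search r kept) rs))

pattern s₀ = 0F
pattern s₁ = 1F
pattern s₂ = 2F
pattern s₃ = 3F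
pattern x₁ = 4F
pattern x₂ = 5F
pattern a₁ = 6F
pattern a₂ = 7F
pattern a₃ = 8F
pattern b₀ = 9F
pattern b₁ = suc 9F
pattern b₂ = suc (suc 9F)
pattern b₃ = suc (suc (suc 9F))
pattern w₀ = suc (suc (suc (suc 9F)))

sᵢ bᵢ : Fin 4 → Fin 14
sᵢ 0F = s₀
sᵢ 1F = s₁
sᵢ 2F = s₂
sᵢ 3F = s₃
bᵢ 0F = b₀
bᵢ 1F = b₁
bᵢ 2F = b₂
bᵢ 3F = b₃

lane : Fin 4 → Bool → Bool
lane 0F _    = false
lane 1F side = side
lane 2F side = not side
lane 3F _    = true

fixedPairs : Fin 4 → Vec (Fin 14 × Fin 14) 6
fixedPairs 0F = (s₀ , x₁) ∷ (s₁ , x₂) ∷ (s₂ , b₂) ∷ (a₁ , b₁) ∷ (a₂ , b₀) ∷ (a₃ , b₃) ∷ []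
fixedPairs 1F = (s₀ , x₂) ∷ (s₁ , x₁) ∷ (s₃ , b₃) ∷ (a₃ , b₂) ∷ (a₁ , a₂) ∷ (b₀ , b₁) ∷ []
fixedPairs 2F = (s₀ , b₀) ∷ (s₂ , x₁) ∷ (s₃ , x₂) ∷ (a₁ , b₂) ∷ (a₂ , b₃) ∷ (a₃ , b₁) ∷ []
fixedPairs 3F = (s₁ , b₁) ∷ (s₂ , x₂) ∷ (s₃ , x₁) ∷ (a₁ , b₃) ∷ (a₂ , b₂) ∷ (a₃ , b₀) ∷ []

fixedPair : Fin 4 → Fin 6 → Fin 14 × Fin 14
fixedPair k = Vec.lookup (fixedPairs k)

leftEnd rightEnd : Fin 4 → Fin 14
leftEnd 0F = s₃
leftEnd 1F = w₀
leftEnd 2F = w₀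
leftEnd 3F = s₀
rightEnd 0F = w₀
rightEnd 1F = s₂
rightEnd 2F = s₁
rightEnd 3F = w₀

endOf? : ∀ {n} (c : Fin n) p → Dec (c IsEndOf p)
endOf? c (a , b) = (c ≟ a) ⊎-dec (c ≟ b)

-- Finite facts about the core, checked by evaluation; opaque so that their proofs are never unfolded.
opaque
  core-covered : ∀ k c → (∃ λ i → c IsEndOf fixedPair k i) ⊎ c ≡ leftEnd k ⊎ c ≡ rightEnd k
  core-covered = from-yes (all? λ k → all? λ c → any? (λ i → endOf? c (fixedPair k i)) ⊎-dec (c ≟ leftEnd k) ⊎-dec (c ≟ rightEnd k))

  fixedPairs-disjoint : ∀ k i i′ c → c IsEndOf fixedPair k i → c IsEndOf fixedPair k i′ → i ≡ i′
  fixedPairs-disjoint = from-yes (all? λ k → all? λ i → all? λ i′ → all? λ c →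
    endOf? c (fixedPair k i) →-dec endOf? c (fixedPair k i′) →-dec i ≟ i′)

  ends-unpaired : ∀ k i → ¬ leftEnd k IsEndOf fixedPair k i × ¬ rightEnd k IsEndOf fixedPair k i
  ends-unpaired = from-yes (all? λ k → all? λ i → ¬? (endOf? (leftEnd k) (fixedPair k i)) ×-dec ¬? (endOf? (rightEnd k) (fixedPair k i)))

  leftEnd≢rightEnd : ∀ k → leftEnd k ≢ rightEnd k
  leftEnd≢rightEnd = from-yes (all? λ k → ¬? (leftEnd k ≟ rightEnd k))

  fixedPair-loopless : ∀ k i → proj₁ (fixedPair k i) ≢ proj₂ (fixedPair k i)
  fixedPair-loopless = from-yes (all? λ k → all? λ i → ¬? (proj₁ (fixedPair k i) ≟ proj₂ (fixedPair k i)))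

-- Unlike Fin.any?, this search computes with does only, which keeps evaluation on the core cheap.
pairIndex : ∀ {m} → Fin 14 → Vec (Fin 14 × Fin 14) m → Maybe (Fin m)
pairIndex c []       = nothing
pairIndex c (p ∷ ps) with endOf? c p
... | yes _ = just zero
... | no _  = Maybe.map suc (pairIndex c ps)

pairIndex-just : ∀ {m} c (ps : Vec (Fin 14 × Fin 14) m) {i} → pairIndex c ps ≡ just i → c IsEndOf Vec.lookup ps i
pairIndex-just c (p ∷ ps) eq with endOf? c p
pairIndex-just c (p ∷ ps) refl | yes c∈ = c∈
pairIndex-just c (p ∷ ps) eq   | no _ with pairIndex c ps in eq′
pairIndex-just c (p ∷ ps) refl | no _ | just i = pairIndex-just c ps eq′

pairIndex-nothing : ∀ {m} c (ps : Vec (Fin 14 × Fin 14) m) → pairIndex c ps ≡ nothing → ∀ i → ¬ c IsEndOf Vec.lookup ps i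
pairIndex-nothing c (p ∷ ps) eq i c∈ with endOf? c p
pairIndex-nothing c (p ∷ ps) () i c∈ | yes _
pairIndex-nothing c (p ∷ ps) eq zero c∈ | no c∉ = c∉ c∈
pairIndex-nothing c (p ∷ ps) eq (suc i) c∈ | no _ with pairIndex c ps in eq′
pairIndex-nothing c (p ∷ ps) eq (suc i) c∈ | no _ | nothing = pairIndex-nothing c ps eq′ i c∈

-- A vertex is a core vertex or rung j side ℓ: rung j is a K₂,₂ with sides false and true, and every side has
-- a lane false and a lane true. A slot of a base matching is a fixed core pair, the edge of rung j, or a
-- crossing: crossing 0 enters rung 0 from the core, crossing (suc j) leaves rung j.
pattern core c = inj₁ c
pattern rung j side ℓ = inj₂ (j , side , ℓ)
pattern fixed i = inj₁ i
pattern rungSlot j = inj₂ (inj₁ j)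
pattern crossing c = inj₂ (inj₂ c)

module Ladder (u : ℕ) where

  Rung : Set
  Rung = Fin (suc u)

  Vertex : Set
  Vertex = Fin 14 ⊎ (Rung × Bool × Bool)

  Slot : Set
  Slot = Fin 6 ⊎ (Rung ⊎ Fin (2 + u))

  crossingEnd : Fin 4 → Rung → Vertex
  crossingEnd k j with view j
  ... | ‵fromℕ     = core (rightEnd k)
  ... | ‵inject₁ j′ = rung (suc j′) false (not (lane k false))

  crossingEnd-last : ∀ k → crossingEnd k (fromℕ u) ≡ core (rightEnd k)
  crossingEnd-last k rewrite view-fromℕ u = refl

  crossingEnd-inject₁ : ∀ k j → crossingEnd k (inject₁ j) ≡ rung (suc j) false (not (lane k false))
  crossingEnd-inject₁ k j rewrite view-inject₁ j = refl

  base : Fin 4 → Slot → Vertex × Vertex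
  base k (fixed i)          = core (proj₁ (fixedPair k i)) , core (proj₂ (fixedPair k i))
  base k (rungSlot j)       = rung j false (lane k false) , rung j true (lane k true)
  base k (crossing zero)    = core (leftEnd k) , rung zero false (not (lane k false))
  base k (crossing (suc j)) = rung j true (not (lane k true)) , crossingEnd k j

  offLaneCrossing : Bool → Rung → Fin (2 + u)
  offLaneCrossing false j = inject₁ j
  offLaneCrossing true  j = suc j

  coreSlot : Fin 4 → Fin 14 → Slot
  coreSlot k c with pairIndex c (fixedPairs k)
  ... | just i  = fixed i
  ... | nothing = if does (c ≟ leftEnd k) then crossing zero else crossing (fromℕ (suc u))

  slot : Fin 4 → Vertex → Slot
  slot k (core c) = coreSlot k c
  slot k (rung j side ℓ) with ℓ Bool.≟ lane k side
  ... | yes _ = rungSlot j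
  ... | no _  = crossing (offLaneCrossing side j)

  slot-on-lane : ∀ k j side → slot k (rung j side (lane k side)) ≡ rungSlot j
  slot-on-lane k j side with lane k side Bool.≟ lane k side
  ... | yes _ = refl
  ... | no ne = ⊥-elim (ne refl)

  slot-off-lane : ∀ k j side → slot k (rung j side (not (lane k side))) ≡ crossing (offLaneCrossing side j)
  slot-off-lane k j side with not (lane k side) Bool.≟ lane k side
  ... | yes eq = ⊥-elim (Bool.not-¬ refl (sym eq))
  ... | no _  = refl

  coreSlot-fixed : ∀ k i c → c IsEndOf fixedPair k i → coreSlot k c ≡ fixed i
  coreSlot-fixed k i c c∈ with pairIndex c (fixedPairs k) in eq
  ... | just i′  = cong fixed (fixedPairs-disjoint k i′ i c (pairIndex-just c (fixedPairs k) eq) c∈)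
  ... | nothing = ⊥-elim (pairIndex-nothing c (fixedPairs k) eq i c∈)

  unpaired-coreSlot : ∀ k c → (∀ i → ¬ c IsEndOf fixedPair k i) →
    coreSlot k c ≡ (if does (c ≟ leftEnd k) then crossing zero else crossing (fromℕ (suc u)))
  unpaired-coreSlot k c c∉ with pairIndex c (fixedPairs k) in eq
  ... | just i  = ⊥-elim (c∉ i (pairIndex-just c (fixedPairs k) eq))
  ... | nothing = refl

  coreSlot-leftEnd : ∀ k → coreSlot k (leftEnd k) ≡ crossing zero
  coreSlot-leftEnd k with leftEnd k ≟ leftEnd k | unpaired-coreSlot k (leftEnd k) (λ i → proj₁ (ends-unpaired k i))
  ... | yes _ | eq = eq
  ... | no ne | _  = ⊥-elim (ne refl)

  coreSlot-rightEnd : ∀ k → coreSlot k (rightEnd k) ≡ crossing (fromℕ (suc u))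
  coreSlot-rightEnd k with rightEnd k ≟ leftEnd k | unpaired-coreSlot k (rightEnd k) (λ i → proj₂ (ends-unpaired k i))
  ... | yes eq′ | _ = ⊥-elim (leftEnd≢rightEnd k (sym eq′))
  ... | no _ | eq   = eq

  crossingEnd-slot : ∀ k j → slot k (crossingEnd k j) ≡ crossing (suc j)
  crossingEnd-slot k j = go (view j)
    where
    go : ∀ {j} → View j → slot k (crossingEnd k j) ≡ crossing (suc j)
    go ‵fromℕ = trans (cong (slot k) (crossingEnd-last k)) (coreSlot-rightEnd k)
    go (‵inj₁ {i = j′} _) = trans (cong (slot k) (crossingEnd-inject₁ k j′)) (slot-off-lane k (suc j′) false)

  core-endOf : ∀ {c p} → c IsEndOf p → (Vertex ∋ core c) IsEndOf (core (proj₁ p) , core (proj₂ p))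
  core-endOf (inj₁ refl) = inj₁ refl
  core-endOf (inj₂ refl) = inj₂ refl

  coreSlot-endOf : ∀ k c → core c IsEndOf base k (coreSlot k c)
  coreSlot-endOf k c with core-covered k c
  ... | inj₁ (i , c∈) = subst (λ s → core c IsEndOf base k s) (sym (coreSlot-fixed k i c c∈)) (core-endOf c∈)
  ... | inj₂ (inj₁ refl) = subst (λ s → core c IsEndOf base k s) (sym (coreSlot-leftEnd k)) (inj₁ refl)
  ... | inj₂ (inj₂ refl) = subst (λ s → core c IsEndOf base k s) (sym (coreSlot-rightEnd k)) (inj₂ (sym (crossingEnd-last k)))

  slot-endOf : ∀ k v → v IsEndOf base k (slot k v)
  slot-endOf k (core c) = coreSlot-endOf k c
  slot-endOf k (rung j side ℓ) with ℓ Bool.≟ lane k side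
  slot-endOf k (rung j false ℓ) | yes refl = inj₁ refl
  slot-endOf k (rung j true ℓ)  | yes refl = inj₂ refl
  slot-endOf k (rung j true ℓ)  | no ℓ≢ = inj₁ (cong (rung j true) (Bool.¬-not ℓ≢))
  slot-endOf k (rung zero false ℓ) | no ℓ≢ = inj₂ (cong (rung zero false) (Bool.¬-not ℓ≢))
  slot-endOf k (rung (suc j) false ℓ) | no ℓ≢ =
    inj₂ (trans (cong (rung (suc j) false) (Bool.¬-not ℓ≢)) (sym (crossingEnd-inject₁ k j)))

  endOf-slot : ∀ k s v → v IsEndOf base k s → s ≡ slot k v
  endOf-slot k (fixed i) _ (inj₁ refl) = sym (coreSlot-fixed k i _ (inj₁ refl))
  endOf-slot k (fixed i) _ (inj₂ refl) = sym (coreSlot-fixed k i _ (inj₂ refl))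
  endOf-slot k (rungSlot j) _ (inj₁ refl) = sym (slot-on-lane k j false)
  endOf-slot k (rungSlot j) _ (inj₂ refl) = sym (slot-on-lane k j true)
  endOf-slot k (crossing zero) _ (inj₁ refl) = sym (coreSlot-leftEnd k)
  endOf-slot k (crossing zero) _ (inj₂ refl) = sym (slot-off-lane k zero false)
  endOf-slot k (crossing (suc j)) _ (inj₁ refl) = sym (slot-off-lane k j true)
  endOf-slot k (crossing (suc j)) _ (inj₂ refl) = sym (crossingEnd-slot k j)

  base-loopless : ∀ k s → proj₁ (base k s) ≢ proj₂ (base k s)
  base-loopless k (fixed i) eq = fixedPair-loopless k i (Sum.inj₁-injective eq)
  base-loopless k (rungSlot j) ()
  base-loopless k (crossing zero) ()
  base-loopless k (crossing (suc j)) = go (view j)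
    where
    go : ∀ {j} → View j → rung j true (not (lane k true)) ≢ crossingEnd k j
    go ‵fromℕ eq with trans eq (crossingEnd-last k)
    ... | ()
    go (‵inj₁ {i = j′} _) eq with trans eq (crossingEnd-inject₁ k j′)
    ... | ()

  vertexCode : Vertex ↔ Fin (14 + suc u * 4)
  vertexCode = ↔-sym (↔-trans +↔⊎ (↔-refl ⊎-↔ ↔-trans *↔× (↔-refl ×-↔ ↔-trans (*↔× {2} {2}) (2↔Bool ×-↔ 2↔Bool))))

  slotCode : Slot ↔ Fin (6 + (suc u + (2 + u)))
  slotCode = ↔-sym (↔-trans +↔⊎ (↔-refl ⊎-↔ +↔⊎))

module LadderGraph (u r′ : ℕ) where
  open Ladder u public

  -- Colours 4, 5, … repeat base matching 0 as parallel edges.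
  colourClass : Fin (4 + r′) → Fin 4
  colourClass 0F = 0F
  colourClass 1F = 1F
  colourClass 2F = 2F
  colourClass 3F = 3F
  colourClass (suc (suc (suc (suc _)))) = 0F

  open MatchingUnion vertexCode slotCode (λ c → base (colourClass c)) (λ c → slot (colourClass c))
    (λ c → slot-endOf (colourClass c)) (λ c → endOf-slot (colourClass c)) (λ c → base-loopless (colourClass c))
    public

  _≟V_ : DecidableEquality Vertex
  _≟V_ = Sum.≡-dec Fin._≟_ (Product.≡-dec Fin._≟_ (Product.≡-dec Bool._≟_ Bool._≟_))

  opposite : Fin 4 → Vertex → Vertex
  opposite k v = other _≟V_ v (base k (slot k v))

  colourClass-1F : ∀ c → colourClass c ≡ 1F → c ≡ 1F
  colourClass-1F 1F _ = refl
  colourClass-1F 0F ()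
  colourClass-1F 2F ()
  colourClass-1F 3F ()
  colourClass-1F (suc (suc (suc (suc _)))) ()

  only-edge : ∀ {v z} → (∀ k → Joins (base k (slot k v)) v z → k ≡ 1F) →
    ∀ c s → Joins (base (colourClass c) s) v z → edge c s ≡ edge 1F (slot 1F v)
  only-edge {v} only-1F c s j with endOf-slot (colourClass c) s v (joins⇒endOf j)
  ... | refl with colourClass-1F c (only-1F (colourClass c) j)
  ...   | refl = refl

  E₁ E₂ : Fin (Graph.m graph)
  E₁ = edge 1F (slot 1F (core a₁))
  E₂ = edge 1F (slot 1F (core b₀))

  E₁≢E₂ : E₁ ≢ E₂
  E₁≢E₂ eq with proj₂ (edge-injective {1F} {1F} {slot 1F (core a₁)} {slot 1F (core b₀)} eq)
  ... | ()

  a₁a₂-only-1F : ∀ k → Joins (base k (slot k (core a₁))) (core a₁) (core a₂) → k ≡ 1F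
  a₁a₂-only-1F 0F (inj₁ ())
  a₁a₂-only-1F 0F (inj₂ ())
  a₁a₂-only-1F 1F _ = refl
  a₁a₂-only-1F 2F (inj₁ ())
  a₁a₂-only-1F 2F (inj₂ ())
  a₁a₂-only-1F 3F (inj₁ ())
  a₁a₂-only-1F 3F (inj₂ ())

  b₀b₁-only-1F : ∀ k → Joins (base k (slot k (core b₀))) (core b₀) (core b₁) → k ≡ 1F
  b₀b₁-only-1F 0F (inj₁ ())
  b₀b₁-only-1F 0F (inj₂ ())
  b₀b₁-only-1F 1F _ = refl
  b₀b₁-only-1F 2F (inj₁ ())
  b₀b₁-only-1F 2F (inj₂ ())
  b₀b₁-only-1F 3F (inj₁ ())
  b₀b₁-only-1F 3F (inj₂ ())

  module PerfectMatchingOfLadder {M : Fin (Graph.m graph) → Bool} (M-perfect : PerfectMatching graph M) where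

    open PartnersUnder M

    infix 4 _~_
    _~_ : Vertex → Vertex → Set
    _~_ = Partner

    ~-unique : ∀ {v z z′} → v ~ z → v ~ z′ → z ≡ z′
    ~-unique = partner-unique M-perfect

    ~-opposite : ∀ v → Σ (Fin 4) λ k → v ~ opposite k v
    ~-opposite v with partner-exists M-perfect v
    ... | z , p with partner-joined p
    ...   | c , j = colourClass c , subst (v ~_) (joins⇒other _≟V_ j) p

    E₁⇔a₁~a₂ : (M E₁ ≡ true → core a₁ ~ core a₂) × (core a₁ ~ core a₂ → M E₁ ≡ true)
    E₁⇔a₁~a₂ = (λ m → partner 1F (slot 1F (core a₁)) m (inj₁ refl)) , λ p → partner⇒member p (only-edge a₁a₂-only-1F)

    E₂⇔b₀~b₁ : (M E₂ ≡ true → core b₀ ~ core b₁) × (core b₀ ~ core b₁ → M E₂ ≡ true)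
    E₂⇔b₀~b₁ = (λ m → partner 1F (slot 1F (core b₀)) m (inj₁ refl)) , λ p → partner⇒member p (only-edge b₀b₁-only-1F)

    clash : ∀ {v v′ z} → v ~ z → v′ ~ z → v ≡ v′
    clash p q = ~-unique (Partner-sym p) (Partner-sym q)

    private
      opaque
        bᵢ-injective : ∀ i j → bᵢ i ≡ bᵢ j → i ≡ j
        bᵢ-injective = from-yes (all? λ i → all? λ j → (bᵢ i Fin.≟ bᵢ j) →-dec (i Fin.≟ j))

        bᵢ≢x : ∀ i → bᵢ i ≢ x₁ × bᵢ i ≢ x₂
        bᵢ≢x = from-yes (all? λ i → ¬? (bᵢ i Fin.≟ x₁) ×-dec ¬? (bᵢ i Fin.≟ x₂))

      x₁-partner : Σ (Fin 4) λ i → core x₁ ~ core (sᵢ i)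
      x₁-partner with ~-opposite (core x₁)
      ... | 0F , p = 0F , p
      ... | 1F , p = 1F , p
      ... | 2F , p = 2F , p
      ... | 3F , p = 3F , p

      x₂-partner : Σ (Fin 4) λ i → core x₂ ~ core (sᵢ i)
      x₂-partner with ~-opposite (core x₂)
      ... | 0F , p = 1F , p
      ... | 1F , p = 0F , p
      ... | 2F , p = 3F , p
      ... | 3F , p = 2F , p

      bᵢ-partner : core a₁ ~ core a₂ → ∀ i →
        core b₀ ~ core b₁ ⊎ core (bᵢ i) ~ core (sᵢ i) ⊎ core (bᵢ i) ~ core a₃
      bᵢ-partner a₁a₂ i = options i (~-opposite (core (bᵢ i)))
        where
        options : ∀ i → Σ (Fin 4) (λ k → core (bᵢ i) ~ opposite k (core (bᵢ i))) →
          core b₀ ~ core b₁ ⊎ core (bᵢ i) ~ core (sᵢ i) ⊎ core (bᵢ i) ~ core a₃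
        options 0F (0F , p) = case clash p a₁a₂ of λ ()
        options 0F (1F , p) = inj₁ p
        options 0F (2F , p) = inj₂ (inj₁ p)
        options 0F (3F , p) = inj₂ (inj₂ p)
        options 1F (0F , p) = case clash p (Partner-sym a₁a₂) of λ ()
        options 1F (1F , p) = inj₁ (Partner-sym p)
        options 1F (2F , p) = inj₂ (inj₂ p)
        options 1F (3F , p) = inj₂ (inj₁ p)
        options 2F (0F , p) = inj₂ (inj₁ p)
        options 2F (1F , p) = inj₂ (inj₂ p)
        options 2F (2F , p) = case clash p (Partner-sym a₁a₂) of λ ()
        options 2F (3F , p) = case clash p a₁a₂ of λ ()
        options 3F (0F , p) = inj₂ (inj₂ p)
        options 3F (1F , p) = inj₂ (inj₁ p)
        options 3F (2F , p) = case clash p a₁a₂ of λ ()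
        options 3F (3F , p) = case clash p (Partner-sym a₁a₂) of λ ()

      aᵢ : Fin 3 → Fin 14
      aᵢ 0F = a₁
      aᵢ 1F = a₂
      aᵢ 2F = a₃

      b₂₃ : Bool → Fin 14
      b₂₃ false = b₂
      b₂₃ true  = b₃

      aᵢ-partner : core b₀ ~ core b₁ → ∀ i →
        core a₁ ~ core a₂ ⊎ Σ Bool λ t → core (aᵢ i) ~ core (b₂₃ t)
      aᵢ-partner b₀b₁ i = options i (~-opposite (core (aᵢ i)))
        where
        options : ∀ i → Σ (Fin 4) (λ k → core (aᵢ i) ~ opposite k (core (aᵢ i))) →
          core a₁ ~ core a₂ ⊎ Σ Bool λ t → core (aᵢ i) ~ core (b₂₃ t)
        options 0F (0F , p) = case clash p b₀b₁ of λ ()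
        options 0F (1F , p) = inj₁ p
        options 0F (2F , p) = inj₂ (false , p)
        options 0F (3F , p) = inj₂ (true , p)
        options 1F (0F , p) = case clash p (Partner-sym b₀b₁) of λ ()
        options 1F (1F , p) = inj₁ (Partner-sym p)
        options 1F (2F , p) = inj₂ (true , p)
        options 1F (3F , p) = inj₂ (false , p)
        options 2F (0F , p) = inj₂ (true , p)
        options 2F (1F , p) = inj₂ (false , p)
        options 2F (2F , p) = case clash p b₀b₁ of λ ()
        options 2F (3F , p) = case clash p (Partner-sym b₀b₁) of λ ()

    -- x₁ and x₂ need two distinct sᵢ; the corresponding bᵢ would both have to take a₃.
    a₁~a₂⇒b₀~b₁ : core a₁ ~ core a₂ → core b₀ ~ core b₁
    a₁~a₂⇒b₀~b₁ a₁a₂ = conclude x₁-partner x₂-partner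
      where
      conclude : Σ (Fin 4) (λ i → core x₁ ~ core (sᵢ i)) → Σ (Fin 4) (λ i → core x₂ ~ core (sᵢ i)) → core b₀ ~ core b₁
      conclude (i , x₁s) (i′ , x₂s) = cases (bᵢ-partner a₁a₂ i) (bᵢ-partner a₁a₂ i′)
        where
        cases : core b₀ ~ core b₁ ⊎ core (bᵢ i) ~ core (sᵢ i) ⊎ core (bᵢ i) ~ core a₃ →
                core b₀ ~ core b₁ ⊎ core (bᵢ i′) ~ core (sᵢ i′) ⊎ core (bᵢ i′) ~ core a₃ → core b₀ ~ core b₁
        cases (inj₁ b₀b₁) _ = b₀b₁
        cases _ (inj₁ b₀b₁) = b₀b₁
        cases (inj₂ (inj₁ bs)) _ = ⊥-elim (proj₁ (bᵢ≢x i) (Sum.inj₁-injective (clash bs x₁s)))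
        cases _ (inj₂ (inj₁ bs)) = ⊥-elim (proj₂ (bᵢ≢x i′) (Sum.inj₁-injective (clash bs x₂s)))
        cases (inj₂ (inj₂ ba)) (inj₂ (inj₂ b′a)) =
          ⊥-elim (x₁≢x₂ (clash x₁s (subst (λ i → core x₂ ~ core (sᵢ i)) (sym (bᵢ-injective i i′ (Sum.inj₁-injective (clash ba b′a)))) x₂s)))
          where
          x₁≢x₂ : core x₁ ≢ core x₂
          x₁≢x₂ ()

    -- Three vertices a₁ a₂ a₃ cannot all be matched into {b₂ , b₃}.
    b₀~b₁⇒a₁~a₂ : core b₀ ~ core b₁ → core a₁ ~ core a₂
    b₀~b₁⇒a₁~a₂ b₀b₁ = cases (aᵢ-partner b₀b₁ 0F) (aᵢ-partner b₀b₁ 1F) (aᵢ-partner b₀b₁ 2F)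
      where
      Options : Fin 3 → Set
      Options i = core a₁ ~ core a₂ ⊎ Σ Bool λ t → core (aᵢ i) ~ core (b₂₃ t)

      cases : Options 0F → Options 1F → Options 2F → core a₁ ~ core a₂
      cases (inj₁ a₁a₂) _ _ = a₁a₂
      cases _ (inj₁ a₁a₂) _ = a₁a₂
      cases _ _ (inj₁ a₁a₂) = a₁a₂
      cases (inj₂ (t₁ , p₁)) (inj₂ (t₂ , p₂)) (inj₂ (t₃ , p₃)) = ⊥-elim (collide (pigeonhole₃ t₁ t₂ t₃))
        where
        collide : t₁ ≡ t₂ ⊎ t₁ ≡ t₃ ⊎ t₂ ≡ t₃ → ⊥
        collide (inj₁ refl) = case clash p₁ p₂ of λ ()
        collide (inj₂ (inj₁ refl)) = case clash p₁ p₃ of λ ()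
        collide (inj₂ (inj₂ refl)) = case clash p₂ p₃ of λ ()

  equivalent-E₁E₂ : EquivalentSet graph (Pair graph E₁ E₂)
  equivalent-E₁E₂ = equivalentPair graph
    (λ M perfect → let open PerfectMatchingOfLadder perfect in
      λ m → proj₂ E₂⇔b₀~b₁ (a₁~a₂⇒b₀~b₁ (proj₁ E₁⇔a₁~a₂ m)))
    (λ M perfect → let open PerfectMatchingOfLadder perfect in
      λ m → proj₂ E₁⇔a₁~a₂ (b₀~b₁⇒a₁~a₂ (proj₁ E₂⇔b₀~b₁ m)))

  -- w₀, then rung 0, …, rung u along lane false, then back to w₀: a cycle of odd length 2u + 3 avoiding colour 1.
  not-bipartite : ¬ BipartiteWithout graph E₁ E₂
  not-bipartite (f , proper) = w₀-right (trans (rung-flip (fromℕ u)) (trans (cong not (lane-constant (fromℕ u))) (sym w₀-left)))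
    where
    g : Vertex → Bool
    g v = f (encode v)

    separated : ∀ c s → c ≢ 1F → g (proj₁ (base (colourClass c) s)) ≢ g (proj₂ (base (colourClass c) s))
    separated c s c≢1 = subst (λ p → f (proj₁ p) ≢ f (proj₂ p)) (ends-edge c s) (proper (edge c s) outside)
      where
      outside : ¬ Pair graph E₁ E₂ (edge c s)
      outside (inj₁ eq) = c≢1 (proj₁ (edge-injective {c} {1F} {s} {slot 1F (core a₁)} eq))
      outside (inj₂ eq) = c≢1 (proj₁ (edge-injective {c} {1F} {s} {slot 1F (core b₀)} eq))

    h : Rung → Bool
    h j = g (rung j false false)

    rung-flip : ∀ j → g (rung j true false) ≡ not (h j)
    rung-flip j = Bool.¬-not (≢-sym (separated 0F (rungSlot j) (λ ())))

    lane-step : ∀ j → h (inject₁ j) ≡ h zero → h (suc j) ≡ h zero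
    lane-step j ih = begin
      h (suc j)                        ≡⟨ Bool.¬-not (subst (λ v → g v ≢ g (rung (inject₁ j) true false)) (crossingEnd-inject₁ 3F j)
                                            (≢-sym (separated 3F (crossing (suc (inject₁ j))) (λ ())))) ⟩
      not (g (rung (inject₁ j) true false)) ≡⟨ cong not (rung-flip (inject₁ j)) ⟩
      not (not (h (inject₁ j)))        ≡⟨ Bool.not-involutive _ ⟩
      h (inject₁ j)                    ≡⟨ ih ⟩
      h zero                           ∎
      where open ≡-Reasoning

    lane-constant : ∀ j → h j ≡ h zero
    lane-constant = <-weakInduction (λ j → h j ≡ h zero) refl lane-step

    w₀-left : g (core w₀) ≡ not (h zero)
    w₀-left = Bool.¬-not (separated 2F (crossing zero) (λ ()))

    w₀-right : g (rung (fromℕ u) true false) ≢ g (core w₀)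
    w₀-right = subst (λ v → g (rung (fromℕ u) true false) ≢ g v) (crossingEnd-last 3F) (separated 3F (crossing (suc (fromℕ u))) (λ ()))

module LadderConnectivity (u r′ : ℕ) where
  open LadderGraph u r′

  open Fans graph encode encode-injective
  open DecDisjoint _≟V_ using (disjoint?)
  open DecUnique _≟V_ using (unique?)

  base-adjacent : ∀ k s → proj₁ (base k s) — proj₂ (base k s)
  base-adjacent 0F s = adj (adjacent 0F s)
  base-adjacent 1F s = adj (adjacent 1F s)
  base-adjacent 2F s = adj (adjacent 2F s)
  base-adjacent 3F s = adj (adjacent 3F s)

  Paired : Fin 14 → Fin 14 → Set
  Paired c d = Σ (Fin 4) λ k → Σ (Fin 6) λ i → Joins (fixedPair k i) c d

  paired? : ∀ c d → Dec (Paired c d)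
  paired? c d = any? λ k → any? λ i → (fixedPair k i ≟² (c , d)) ⊎-dec (fixedPair k i ≟² (d , c))
    where _≟²_ = Product.≡-dec Fin._≟_ Fin._≟_

  paired-edge : ∀ {c d} → Paired c d → core c — core d
  paired-edge (k , i , inj₁ eq) = subst CoreEdge eq (base-adjacent k (fixed i))
    where
    CoreEdge : Fin 14 × Fin 14 → Set
    CoreEdge (c , d) = core c — core d
  paired-edge (k , i , inj₂ eq) = —-sym (paired-edge (k , i , inj₁ eq))

  core-edge : ∀ c d → {True (paired? c d)} → core c — core d
  core-edge c d {paired} = paired-edge (toWitness paired)

  CoreChain : Fin 14 → List (Fin 14) → Set
  CoreChain c []       = Σ (Fin 4) λ i → c ≡ sᵢ i
  CoreChain c (d ∷ ds) = Paired c d × CoreChain d ds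

  chain? : ∀ c ds → Dec (CoreChain c ds)
  chain? c []       = any? λ i → c Fin.≟ sᵢ i
  chain? c (d ∷ ds) = paired? c d ×-dec chain? d ds

  rung-edge : ∀ j ℓ ℓ′ → rung j false ℓ — rung j true ℓ′
  rung-edge j false false = base-adjacent 0F (rungSlot j)
  rung-edge j false true  = base-adjacent 1F (rungSlot j)
  rung-edge j true  false = base-adjacent 2F (rungSlot j)
  rung-edge j true  true  = base-adjacent 3F (rungSlot j)

  crossing-edge : ∀ k j → rung (inject₁ j) true (not (lane k true)) — rung (suc j) false (not (lane k false))
  crossing-edge k j = subst (rung (inject₁ j) true (not (lane k true)) —_) (crossingEnd-inject₁ k j)
    (base-adjacent k (crossing (suc (inject₁ j))))

  cross-edge : ∀ j ℓ ℓ′ → rung (inject₁ j) true ℓ — rung (suc j) false ℓ′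
  cross-edge j true  true  = crossing-edge 0F j
  cross-edge j false true  = crossing-edge 1F j
  cross-edge j true  false = crossing-edge 2F j
  cross-edge j false false = crossing-edge 3F j

  -- The core vertices attached to the two ends of the ladder: end false is rung 0, end true is rung u.
  stub : Bool → Bool → Fin 14
  stub false false = s₀
  stub false true  = s₃
  stub true  false = s₂
  stub true  true  = s₁

  endIndex : Bool → Rung
  endIndex false = zero
  endIndex true  = fromℕ u

  endRung : Bool → Bool → Vertex
  endRung dir ℓ = rung (endIndex dir) dir ℓ

  last-crossing-edge : ∀ k → rung (fromℕ u) true (not (lane k true)) — core (rightEnd k)
  last-crossing-edge k = subst (rung (fromℕ u) true (not (lane k true)) —_) (crossingEnd-last k)
    (base-adjacent k (crossing (suc (fromℕ u))))

  end-stub-edge : ∀ dir ℓ → endRung dir ℓ — core (stub dir ℓ)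
  end-stub-edge false false = —-sym (base-adjacent 3F (crossing zero))
  end-stub-edge false true  = —-sym (base-adjacent 0F (crossing zero))
  end-stub-edge true  false = last-crossing-edge 1F
  end-stub-edge true  true  = last-crossing-edge 2F

  end-w₀-edge : ∀ dir ℓ → endRung dir ℓ — core w₀
  end-w₀-edge false false = —-sym (base-adjacent 2F (crossing zero))
  end-w₀-edge false true  = —-sym (base-adjacent 1F (crossing zero))
  end-w₀-edge true  false = last-crossing-edge 3F
  end-w₀-edge true  true  = last-crossing-edge 0F

  core-injective : ∀ {c d} → core c ≡ (Vertex ∋ core d) → c ≡ d
  core-injective refl = refl

  data Anchor : Vertex → Set where
    s-anchor  : ∀ i → Anchor (core (sᵢ i))
    x₁-anchor : Anchor (core x₁)
    x₂-anchor : Anchor (core x₂)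

  stub-anchor : ∀ dir ℓ → Anchor (core (stub dir ℓ))
  stub-anchor false false = s-anchor 0F
  stub-anchor false true  = s-anchor 3F
  stub-anchor true  false = s-anchor 2F
  stub-anchor true  true  = s-anchor 1F

  stub-injective : ∀ {dir dir′ ℓ ℓ′} → stub dir ℓ ≡ stub dir′ ℓ′ → dir ≡ dir′ × ℓ ≡ ℓ′
  stub-injective {false} {false} {false} {false} _ = refl , refl
  stub-injective {false} {false} {true}  {true}  _ = refl , refl
  stub-injective {true}  {true}  {false} {false} _ = refl , refl
  stub-injective {true}  {true}  {true}  {true}  _ = refl , refl
  stub-injective {false} {false} {false} {true}  ()
  stub-injective {false} {false} {true}  {false} ()
  stub-injective {true}  {true}  {false} {true}  ()
  stub-injective {true}  {true}  {true}  {false} ()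
  stub-injective {false} {true}  {false} {false} ()
  stub-injective {false} {true}  {false} {true}  ()
  stub-injective {false} {true}  {true}  {false} ()
  stub-injective {false} {true}  {true}  {true}  ()
  stub-injective {true}  {false} {false} {false} ()
  stub-injective {true}  {false} {false} {true}  ()
  stub-injective {true}  {false} {true}  {false} ()
  stub-injective {true}  {false} {true}  {true}  ()

  stub≢w₀ : ∀ dir ℓ → stub dir ℓ ≢ w₀
  stub≢w₀ false false ()
  stub≢w₀ false true  ()
  stub≢w₀ true  false ()
  stub≢w₀ true  true  ()

  position : Rung → Bool → ℕ
  position j false = toℕ j + toℕ j
  position j true  = suc (toℕ j + toℕ j)

  position-rung : ∀ j → position j false < position j true
  position-rung j = n<1+n _

  position-cross : ∀ j → position (inject₁ j) true < position (suc j) false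
  position-cross j rewrite Fin.toℕ-inject₁ j | +-suc (toℕ j) (toℕ j) = n<1+n _

  Further : Bool → ℕ → ℕ → Set
  Further true  p q = p < q
  Further false p q = q < p

  Further-trans : ∀ dir {p q s} → Further dir p q → Further dir q s → Further dir p s
  Further-trans true  p<q q<s = ℕₚ.<-trans p<q q<s
  Further-trans false q<p s<q = ℕₚ.<-trans s<q q<p

  Further-irrefl : ∀ dir p → ¬ Further dir p p
  Further-irrefl true  p = <-irrefl refl
  Further-irrefl false p = <-irrefl refl

  Beyond : Bool → Bool → ℕ → Vertex → Set
  Beyond dir ℓ p z = z ≡ core (stub dir ℓ) ⊎ Σ Rung λ j → Σ Bool λ side → z ≡ rung j side ℓ × Further dir p (position j side)

  Beyond-weaken : ∀ {dir ℓ p q z} → Further dir p q → Beyond dir ℓ q z → Beyond dir ℓ p z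
  Beyond-weaken _ (inj₁ eq) = inj₁ eq
  Beyond-weaken {dir} p→q (inj₂ (j , side , eq , q→)) = inj₂ (j , side , eq , Further-trans dir p→q q→)

  Beyond-lanes : ∀ dir p → Disjoint (Beyond dir false p) (Beyond dir true p)
  Beyond-lanes dir p (inj₁ refl , inj₁ eq) with () ← proj₂ (stub-injective (core-injective eq))
  Beyond-lanes dir p (inj₁ refl , inj₂ (_ , _ , () , _))
  Beyond-lanes dir p (inj₂ (_ , _ , refl , _) , inj₁ ())
  Beyond-lanes dir p (inj₂ (_ , _ , refl , _) , inj₂ (_ , _ , () , _))

  Beyond-opposite : ∀ ℓ ℓ′ p → Disjoint (Beyond true ℓ p) (Beyond false ℓ′ p)
  Beyond-opposite ℓ ℓ′ p (inj₁ refl , inj₁ eq) with () ← proj₁ (stub-injective (core-injective eq))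
  Beyond-opposite ℓ ℓ′ p (inj₁ refl , inj₂ (_ , _ , () , _))
  Beyond-opposite ℓ ℓ′ p (inj₂ (_ , _ , refl , _) , inj₁ ())
  Beyond-opposite ℓ ℓ′ p (inj₂ (_ , _ , refl , p<q) , inj₂ (_ , _ , refl , q<p)) = <-asym p<q q<p

  module _ (R : List (Fin (Graph.n graph))) (short : length R < 4) where
    open Search R Anchor
    open DecMembership (Fin._≟_ {Graph.n graph}) using (_∈?_)

    step-to : ∀ {dir ℓ p v j side} → v — rung j side ℓ → Further dir p (position j side) →
      EscapesOrBlocked (Beyond dir ℓ (position j side)) (rung j side ℓ) → EscapesOrBlocked (Beyond dir ℓ p) v
    step-to {dir} {ℓ} e further search =
      via e (inj₂ (_ , _ , refl , further)) (λ _ → EscapesOrBlocked-mono (Beyond-weaken {dir} {ℓ} further) search)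

    ahead : ∀ ℓ j side → EscapesOrBlocked (Beyond true ℓ (position j side)) (rung j side ℓ)
    ahead ℓ = >-weakInduction P last previous
      where
      P : Rung → Set
      P j = ∀ side → EscapesOrBlocked (Beyond true ℓ (position j side)) (rung j side ℓ)

      last : P (fromℕ u)
      last true  = via (end-stub-edge true ℓ) (inj₁ refl) (arrive (stub-anchor true ℓ))
      last false = step-to (rung-edge (fromℕ u) ℓ ℓ) (position-rung (fromℕ u)) (last true)

      previous : ∀ j → P (suc j) → P (inject₁ j)
      previous j next true  = step-to (cross-edge j ℓ ℓ) (position-cross j) (next false)
      previous j next false = step-to (rung-edge (inject₁ j) ℓ ℓ) (position-rung (inject₁ j)) (previous j next true)

    behind : ∀ ℓ j side → EscapesOrBlocked (Beyond false ℓ (position j side)) (rung j side ℓ)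
    behind ℓ = <-weakInduction P first next
      where
      P : Rung → Set
      P j = ∀ side → EscapesOrBlocked (Beyond false ℓ (position j side)) (rung j side ℓ)

      first : P zero
      first false = via (end-stub-edge false ℓ) (inj₁ refl) (arrive (stub-anchor false ℓ))
      first true  = step-to (—-sym (rung-edge zero ℓ ℓ)) (position-rung zero) (first false)

      next : ∀ j → P (inject₁ j) → P (suc j)
      next j prev false = step-to (—-sym (cross-edge j ℓ ℓ)) (position-cross j) (prev true)
      next j prev true  = step-to (—-sym (rung-edge (suc j) ℓ ℓ)) (position-rung (suc j)) (next j prev false)

    both-directions : ∀ {v} p → (∀ ℓ → EscapesOrBlocked (Beyond true ℓ p) v) →
      (∀ ℓ → EscapesOrBlocked (Beyond false ℓ p) v) → Escapes v
    both-directions p forward backward =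
      fan (Beyond true false p ∷ Beyond true true p ∷ Beyond false false p ∷ Beyond false true p ∷ [])
        ((Beyond-lanes true p ∷ Beyond-opposite false false p ∷ Beyond-opposite false true p ∷ []) ∷
         (Beyond-opposite true false p ∷ Beyond-opposite true true p ∷ []) ∷
         (Beyond-lanes false p ∷ []) ∷ [] ∷ [])
        short (forward false ∷ forward true ∷ backward false ∷ backward true ∷ [])

    -- At an end of the ladder, the searches past the end are replaced by the stub and a detour through w₀.
    at-end : ∀ dir q → (∀ ℓ → EscapesOrBlocked (Beyond (not dir) ℓ (position (endIndex dir) dir)) (endRung dir q)) →
      Escapes (endRung dir q)
    at-end dir q inward =
      fan (Stub ∷ Detour ∷ Beyond (not dir) false p ∷ Beyond (not dir) true p ∷ [])
        ((stub-detour ∷ stub-inward false ∷ stub-inward true ∷ []) ∷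
         (detour-inward false ∷ detour-inward true ∷ []) ∷
         (Beyond-lanes (not dir) p ∷ []) ∷ [] ∷ [])
        short (direct ∷ detour ∷ inward false ∷ inward true ∷ [])
      where
      p : ℕ
      p = position (endIndex dir) dir

      Stub Detour : Vertex → Set
      Stub z = z ≡ core (stub dir q)
      Detour z = z ≡ core w₀ ⊎ z ≡ endRung dir (not q) ⊎ z ≡ core (stub dir (not q))

      direct : EscapesOrBlocked Stub (endRung dir q)
      direct = via (end-stub-edge dir q) refl (arrive (stub-anchor dir q))

      detour : EscapesOrBlocked Detour (endRung dir q)
      detour = via (end-w₀-edge dir q) (inj₁ refl) λ _ →
               via (—-sym (end-w₀-edge dir (not q))) (inj₂ (inj₁ refl)) λ _ →
               via (end-stub-edge dir (not q)) (inj₂ (inj₂ refl)) (arrive (stub-anchor dir (not q)))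

      stub-detour : Disjoint Stub Detour
      stub-detour (refl , inj₁ eq) = stub≢w₀ dir q (core-injective eq)
      stub-detour (refl , inj₂ (inj₁ ()))
      stub-detour (refl , inj₂ (inj₂ eq)) = Bool.not-¬ refl (proj₂ (stub-injective (core-injective eq)))

      stub-inward : ∀ ℓ → Disjoint Stub (Beyond (not dir) ℓ p)
      stub-inward ℓ (refl , inj₁ eq) = Bool.not-¬ refl (proj₁ (stub-injective (core-injective eq)))
      stub-inward ℓ (refl , inj₂ (_ , _ , () , _))

      detour-inward : ∀ ℓ → Disjoint Detour (Beyond (not dir) ℓ p)
      detour-inward ℓ (inj₁ refl , inj₁ eq) = stub≢w₀ (not dir) ℓ (sym (core-injective eq))
      detour-inward ℓ (inj₁ refl , inj₂ (_ , _ , () , _))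
      detour-inward ℓ (inj₂ (inj₁ refl) , inj₁ ())
      detour-inward ℓ (inj₂ (inj₁ refl) , inj₂ (_ , _ , refl , further)) = Further-irrefl (not dir) p further
      detour-inward ℓ (inj₂ (inj₂ refl) , inj₁ eq) = Bool.not-¬ refl (proj₁ (stub-injective (core-injective eq)))
      detour-inward ℓ (inj₂ (inj₂ refl) , inj₂ (_ , _ , () , _))

    rung-escapes : ∀ j side q → Escapes (rung j side q)
    rung-escapes zero false q = at-end false q λ ℓ →
      step-to (rung-edge zero q ℓ) (position-rung zero) (ahead ℓ zero true)
    rung-escapes (suc j) false q = both-directions (position (suc j) false)
      (λ ℓ → step-to (rung-edge (suc j) q ℓ) (position-rung (suc j)) (ahead ℓ (suc j) true))
      (λ ℓ → step-to (—-sym (cross-edge j ℓ q)) (position-cross j) (behind ℓ (inject₁ j) true))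
    rung-escapes j true q = by-view (view j)
      where
      by-view : ∀ {j} → View j → Escapes (rung j true q)
      by-view ‵fromℕ = at-end true q λ ℓ →
        step-to (—-sym (rung-edge (fromℕ u) ℓ q)) (position-rung (fromℕ u)) (behind ℓ (fromℕ u) false)
      by-view (‵inj₁ {i = j} _) = both-directions (position (inject₁ j) true)
        (λ ℓ → step-to (cross-edge j q ℓ) (position-cross j) (ahead ℓ (suc j) false))
        (λ ℓ → step-to (—-sym (rung-edge (inject₁ j) ℓ q)) (position-rung (inject₁ j)) (behind ℓ (inject₁ j) false))

    w₀-escapes : Escapes (core w₀)
    w₀-escapes = fan (Spur false false ∷ Spur false true ∷ Spur true false ∷ Spur true true ∷ [])
      ((spurs-disjoint (λ ()) ∷ spurs-disjoint (λ ()) ∷ spurs-disjoint (λ ()) ∷ []) ∷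
       (spurs-disjoint (λ ()) ∷ spurs-disjoint (λ ()) ∷ []) ∷
       (spurs-disjoint (λ ()) ∷ []) ∷ [] ∷ [])
      short (spur false false ∷ spur false true ∷ spur true false ∷ spur true true ∷ [])
      where
      Spur : Bool → Bool → Vertex → Set
      Spur dir ℓ z = z ≡ endRung dir ℓ ⊎ z ≡ core (stub dir ℓ)

      spur : ∀ dir ℓ → EscapesOrBlocked (Spur dir ℓ) (core w₀)
      spur dir ℓ = via (—-sym (end-w₀-edge dir ℓ)) (inj₁ refl) λ _ →
                   via (end-stub-edge dir ℓ) (inj₂ refl) (arrive (stub-anchor dir ℓ))

      spurs-disjoint : ∀ {dir dir′ ℓ ℓ′} → (dir , ℓ) ≢ (dir′ , ℓ′) → Disjoint (Spur dir ℓ) (Spur dir′ ℓ′)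
      spurs-disjoint ne (inj₁ refl , inj₁ eq) = ne (cong proj₂ (Sum.inj₂-injective eq))
      spurs-disjoint ne (inj₁ refl , inj₂ ())
      spurs-disjoint ne (inj₂ refl , inj₁ ())
      spurs-disjoint ne (inj₂ refl , inj₂ eq) with stub-injective (core-injective eq)
      ... | refl , refl = ne refl

    route-of : ∀ {c} ds → CoreChain c ds → Route (core c) (map core ds)
    route-of [] (i , refl) = end (s-anchor i)
    route-of (d ∷ ds) (p , chain) = paired-edge p ◅ route-of ds chain

    core-fan : ∀ c (routes : List (List (Fin 14))) →
      {True (All.all? (chain? c) routes ×-dec allPairs? disjoint? (map (map core) routes))} →
      length R < length routes → Kept (core c) → Escapes (core c)
    core-fan c routes {valid} short′ kept =
      route-fan (map (map core) routes) (proj₂ (toWitness valid)) (subst (length R <_) (sym (length-map _ routes)) short′)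
        (AllP.map⁺ (All.map (λ {ds} → route-of ds) (proj₁ (toWitness valid)))) kept

    escapes : ∀ v → Kept v → Escapes v
    escapes (core s₀) kept = escape _ (s-anchor 0F) kept here
    escapes (core s₁) kept = escape _ (s-anchor 1F) kept here
    escapes (core s₂) kept = escape _ (s-anchor 2F) kept here
    escapes (core s₃) kept = escape _ (s-anchor 3F) kept here
    escapes (core x₁) kept = escape _ x₁-anchor kept here
    escapes (core x₂) kept = escape _ x₂-anchor kept here
    escapes (core a₁) = core-fan a₁ ((b₂ ∷ s₂ ∷ []) ∷ (b₃ ∷ s₃ ∷ []) ∷ (a₂ ∷ b₀ ∷ s₀ ∷ []) ∷ (b₁ ∷ s₁ ∷ []) ∷ []) short
    escapes (core a₂) = core-fan a₂ ((b₀ ∷ s₀ ∷ []) ∷ (b₃ ∷ s₃ ∷ []) ∷ (b₂ ∷ s₂ ∷ []) ∷ (a₁ ∷ b₁ ∷ s₁ ∷ []) ∷ []) short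
    escapes (core a₃) = core-fan a₃ ((b₀ ∷ s₀ ∷ []) ∷ (b₁ ∷ s₁ ∷ []) ∷ (b₂ ∷ s₂ ∷ []) ∷ (b₃ ∷ s₃ ∷ []) ∷ []) short
    escapes (core b₀) = core-fan b₀ ((s₀ ∷ []) ∷ (b₁ ∷ s₁ ∷ []) ∷ (a₂ ∷ b₂ ∷ s₂ ∷ []) ∷ (a₃ ∷ b₃ ∷ s₃ ∷ []) ∷ []) short
    escapes (core b₁) = core-fan b₁ ((s₁ ∷ []) ∷ (b₀ ∷ s₀ ∷ []) ∷ (a₁ ∷ b₂ ∷ s₂ ∷ []) ∷ (a₃ ∷ b₃ ∷ s₃ ∷ []) ∷ []) short
    escapes (core b₂) = core-fan b₂ ((s₂ ∷ []) ∷ (a₃ ∷ b₀ ∷ s₀ ∷ []) ∷ (a₁ ∷ b₁ ∷ s₁ ∷ []) ∷ (a₂ ∷ b₃ ∷ s₃ ∷ []) ∷ []) short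
    escapes (core b₃) = core-fan b₃ ((s₃ ∷ []) ∷ (a₃ ∷ b₀ ∷ s₀ ∷ []) ∷ (a₁ ∷ b₁ ∷ s₁ ∷ []) ∷ (a₂ ∷ b₂ ∷ s₂ ∷ []) ∷ []) short
    escapes (core w₀) _ = w₀-escapes
    escapes (rung j side q) _ = rung-escapes j side q

    ReachKept : Vertex → Vertex → Set
    ReachKept v w = Reach graph (_∉ R) (encode v) (encode w)

    edge-to : ∀ {v w} → v — w → Kept w → ReachKept v w
    edge-to (adj a) kept = step a kept here

    Hub : Set
    Hub = Σ Vertex λ h → ∀ {a} → Anchor a → Kept a → ReachKept a h

    spoke-x₁ : ∀ i → core (sᵢ i) — core x₁
    spoke-x₁ 0F = core-edge s₀ x₁
    spoke-x₁ 1F = core-edge s₁ x₁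
    spoke-x₁ 2F = core-edge s₂ x₁
    spoke-x₁ 3F = core-edge s₃ x₁

    spoke-x₂ : ∀ i → core (sᵢ i) — core x₂
    spoke-x₂ 0F = core-edge s₀ x₂
    spoke-x₂ 1F = core-edge s₁ x₂
    spoke-x₂ 2F = core-edge s₂ x₂
    spoke-x₂ 3F = core-edge s₃ x₂

    kept-spoke : Σ (Fin 4) λ i → Kept (core (sᵢ i))
    kept-spoke = spoke-of (some-kept spokes (toWitness {a? = unique? spokes} _) short)
      where
      spokes : List Vertex
      spokes = core s₀ ∷ core s₁ ∷ core s₂ ∷ core s₃ ∷ []

      spoke-of : Any Kept spokes → Σ (Fin 4) λ i → Kept (core (sᵢ i))
      spoke-of (here kept)                         = 0F , kept
      spoke-of (there (here kept))                 = 1F , kept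
      spoke-of (there (there (here kept)))         = 2F , kept
      spoke-of (there (there (there (here kept)))) = 3F , kept

    hub-x₁ : Kept (core x₁) → Hub
    hub-x₁ kx₁ = core x₁ , reach
      where
      reach : ∀ {a} → Anchor a → Kept a → ReachKept a (core x₁)
      reach (s-anchor i) _ = edge-to (spoke-x₁ i) kx₁
      reach x₁-anchor    _ = here
      reach x₂-anchor    _ = edge-to (—-sym (spoke-x₂ i)) kept ◅◅ edge-to (spoke-x₁ i) kx₁
        where
        i = proj₁ kept-spoke
        kept = proj₂ kept-spoke

    hub-x₂ : encode (core x₁) ∈ R → Kept (core x₂) → Hub
    hub-x₂ x₁∈ kx₂ = core x₂ , reach
      where
      reach : ∀ {a} → Anchor a → Kept a → ReachKept a (core x₂)
      reach (s-anchor i) _    = edge-to (spoke-x₂ i) kx₂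
      reach x₁-anchor    kx₁ = ⊥-elim (kx₁ x₁∈)
      reach x₂-anchor    _    = here

    hub-a₃ : encode (core x₁) ∈ R → encode (core x₂) ∈ R →
      All (λ c → Kept (core c)) (a₃ ∷ b₀ ∷ b₁ ∷ b₂ ∷ b₃ ∷ []) → Hub
    hub-a₃ x₁∈ x₂∈ (ka₃ ∷ kb₀ ∷ kb₁ ∷ kb₂ ∷ kb₃ ∷ []) = core a₃ , reach
      where
      reach : ∀ {a} → Anchor a → Kept a → ReachKept a (core a₃)
      reach (s-anchor 0F) _ = edge-to (core-edge s₀ b₀) kb₀ ◅◅ edge-to (core-edge b₀ a₃) ka₃
      reach (s-anchor 1F) _ = edge-to (core-edge s₁ b₁) kb₁ ◅◅ edge-to (core-edge b₁ a₃) ka₃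
      reach (s-anchor 2F) _ = edge-to (core-edge s₂ b₂) kb₂ ◅◅ edge-to (core-edge b₂ a₃) ka₃
      reach (s-anchor 3F) _ = edge-to (core-edge s₃ b₃) kb₃ ◅◅ edge-to (core-edge b₃ a₃) ka₃
      reach x₁-anchor kx₁ = ⊥-elim (kx₁ x₁∈)
      reach x₂-anchor kx₂ = ⊥-elim (kx₂ x₂∈)

    -- With x₁, x₂ and some c removed, nothing else is; then w₀ is a hub via the stubs.
    hub-w₀ : ∀ c → encode (core x₁) ∈ R → encode (core x₂) ∈ R → encode (core c) ∈ R →
      {True (All.all? (λ v → unique? (core x₁ ∷ core x₂ ∷ core c ∷ v ∷ []))
              (core w₀ ∷ endRung false false ∷ endRung false true ∷ endRung true false ∷ endRung true true ∷ []))} →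
      Hub
    hub-w₀ c x₁∈ x₂∈ c∈ {distinct} with toWitness distinct
    ... | dw₀ ∷ d₀₀ ∷ d₀₁ ∷ d₁₀ ∷ d₁₁ ∷ [] = core w₀ , reach
      where
      kept : ∀ v → Unique (core x₁ ∷ core x₂ ∷ core c ∷ v ∷ []) → Kept v
      kept v d = last (some-kept _ d short)
        where
        last : Any Kept (core x₁ ∷ core x₂ ∷ core c ∷ v ∷ []) → Kept v
        last (here k)                      = ⊥-elim (k x₁∈)
        last (there (here k))              = ⊥-elim (k x₂∈)
        last (there (there (here k)))      = ⊥-elim (k c∈)
        last (there (there (there (here k)))) = k

      through-stub : ∀ dir ℓ → Unique (core x₁ ∷ core x₂ ∷ core c ∷ endRung dir ℓ ∷ []) →
        ReachKept (core (stub dir ℓ)) (core w₀)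
      through-stub dir ℓ d = edge-to (—-sym (end-stub-edge dir ℓ)) (kept _ d) ◅◅ edge-to (end-w₀-edge dir ℓ) (kept _ dw₀)

      reach : ∀ {a} → Anchor a → Kept a → ReachKept a (core w₀)
      reach (s-anchor 0F) _ = through-stub false false d₀₀
      reach (s-anchor 1F) _ = through-stub true  true  d₁₁
      reach (s-anchor 2F) _ = through-stub true  false d₁₀
      reach (s-anchor 3F) _ = through-stub false true  d₀₁
      reach x₁-anchor kx₁ = ⊥-elim (kx₁ x₁∈)
      reach x₂-anchor kx₂ = ⊥-elim (kx₂ x₂∈)

    hub : Hub
    hub = by-x₁ (encode (core x₁) ∈? R)
      where
      by-bridge : encode (core x₁) ∈ R → encode (core x₂) ∈ R →
        Dec (Any (λ c → encode (core c) ∈ R) (a₃ ∷ b₀ ∷ b₁ ∷ b₂ ∷ b₃ ∷ [])) → Hub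
      by-bridge x₁∈ x₂∈ (yes (here c∈))                             = hub-w₀ a₃ x₁∈ x₂∈ c∈
      by-bridge x₁∈ x₂∈ (yes (there (here c∈)))                     = hub-w₀ b₀ x₁∈ x₂∈ c∈
      by-bridge x₁∈ x₂∈ (yes (there (there (here c∈))))             = hub-w₀ b₁ x₁∈ x₂∈ c∈
      by-bridge x₁∈ x₂∈ (yes (there (there (there (here c∈)))))     = hub-w₀ b₂ x₁∈ x₂∈ c∈
      by-bridge x₁∈ x₂∈ (yes (there (there (there (there (here c∈)))))) = hub-w₀ b₃ x₁∈ x₂∈ c∈
      by-bridge x₁∈ x₂∈ (no none) = hub-a₃ x₁∈ x₂∈ (AllP.¬Any⇒All¬ _ none)

      by-x₂ : encode (core x₁) ∈ R → Dec (encode (core x₂) ∈ R) → Hub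
      by-x₂ x₁∈ (no kx₂)  = hub-x₂ x₁∈ kx₂
      by-x₂ x₁∈ (yes x₂∈) = by-bridge x₁∈ x₂∈ (Any.any? (λ c → encode (core c) ∈? R) _)

      by-x₁ : Dec (encode (core x₁) ∈ R) → Hub
      by-x₁ (no kx₁)  = hub-x₁ kx₁
      by-x₁ (yes x₁∈) = by-x₂ x₁∈ (encode (core x₂) ∈? R)

    connected : ∀ v w → Kept v → Kept w → ReachKept v w
    connected v w kv kw = through (escapes v kv) (escapes w kw) hub
      where
      through : Escapes v → Escapes w → Hub → ReachKept v w
      through (escape _ at kt v⇝t) (escape _ at′ kt′ w⇝t′) (_ , to-hub) =
        (v⇝t ◅◅ to-hub at kt) ◅◅ Reach-reverse kw (w⇝t′ ◅◅ to-hub at′ kt′)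

  four-connected : KConnected graph 4
  four-connected = 4<n , λ R short x y x∉ y∉ →
    subst₂ (Reach graph (_∉ R)) (encode-decode x) (encode-decode y)
      (connected R short (decode x) (decode y) (subst (_∉ R) (sym (encode-decode x)) x∉) (subst (_∉ R) (sym (encode-decode y)) y∉))
    where
    4<n : 4 < Graph.n graph
    4<n = ≤-trans (s≤s (s≤s (s≤s (s≤s (s≤s z≤n))))) (m≤m+n 14 _)

N<vertices : ∀ N → N < 14 + suc N * 4
N<vertices N = ≤-trans (n<1+n N) (≤-trans (m≤m*n (suc N) 4) (m≤n+m _ 14))

corollary5p4 : ∀ (r : ℕ) → 4 ≤ r →
    ∀ (N : ℕ) → Σ Graph (λ H → N < Graph.n H × InPsiStar H r)
corollary5p4 _ (s≤s (s≤s (s≤s (s≤s {n = r′} _)))) N =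
  graph , N<vertices N ,
  four-connected , regular , class1 , E₁ , E₂ , E₁≢E₂ , equivalent-E₁E₂ , not-bipartite
  where
  open LadderGraph N r′
  open LadderConnectivity N r′
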